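{- For $n\ge2$ let $a_n$ be the number of nice bijections from $[n-1]$ to $\{2,\ldots,n\}$, and set $a_1=1$. Then \[ \sum_{n\ge1}a_nx^n=x\,c(x), \] where $c(x)=\sum_{k\ge0}C_kx^k$ is the generating function of the Catalan numbers $C_k=\frac{(2k)!}{k!\,(k+1)!}$.
   Context: Let $k\ge1$ and let $f$ be a bijection from $[k]=\{1,\dots,k\}$ to $\{2,\ldots,k+1\}$. Reduction of type 1: if $f(i)=i$ for some $i$, define $f':[k-1]\to\{2,\dots,k\}$ by $f'(j)=\psi(f(\sigma(j)))$, where $\sigma(j)=j$ for $j<i$, $\sigma(j)=j+1$ for $j\ge i$, and $\psi(m)=m$ for $m<i$, $\psi(m)=m-1$ for $m>i$ (i.e. the point $i$ is deleted and the rest relabelled). Reduction of type 2: if $k\ge2$ and $f(i)=i+1$ for some $i$, define $f':[k-1]\to\{2,\dots,k\}$ by $f'(j)=\varphi(f(\sigma(j)))$, where $\sigma(j)=j$ for $j<i$, $\sigma(j)=j+1$ for $j\ge i$, and $\varphi(m)=m$ for $m\le i$, $\varphi(m)=m-1$ for $m>i+1$ (i.e. $i$ and $i+1$ are glued together). The bijection $f$ is called nice if there is a finite sequence of reductions of type 1 or type 2 transforming $f$ into the bijection $[1]\to\{2\}$, $1\mapsto 2$. -}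

module Defs where

open import Data.Nat using (ℕ; zero; suc; _+_; _*_; _∸_; _≤ᵇ_; _!; _/_)
open import Data.Nat.Properties using (_!*_!≢0)
open import Data.Bool using (if_then_else_)
open import Data.List using (List; []; _∷_; _++_; map; length; upTo)
open import Data.List.Membership.Propositional using (_∈_)
open import Data.List.Relation.Unary.Unique.Propositional using (Unique)
open import Data.List.Relation.Binary.Permutation.Propositional using (_↭_)
open import Data.Product using (Σ; _×_)
open import Data.Unit using (⊤)
open import Function.Bundles using (_⇔_)
open import Relation.Binary.PropositionalEquality using (_≡_)

catalan : ℕ → ℕ
catalan k = ((2 * k) ! / (k ! * (suc k) !)) {{k !* suc k !≢0}}

-- A bijection f : [k] → {2,…,k+1} is represented by the list
-- [f(1), …, f(k)] of its values.  It is a bijection iff this list is a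
-- permutation of [2, …, k+1].
IsBij : ℕ → List ℕ → Set
IsBij k xs = xs ↭ map (λ j → 2 + j) (upTo k)

-- relabelling for type 1 reduction at i: m < i ↦ m, m > i ↦ m - 1
-- (the value m = i does not occur among the remaining values)
ψ : ℕ → ℕ → ℕ
ψ i m = if suc m ≤ᵇ i then m else m ∸ 1

-- relabelling for type 2 reduction at i: m ≤ i ↦ m, m > i+1 ↦ m - 1
-- (the value m = i+1 does not occur among the remaining values)
φ : ℕ → ℕ → ℕ
φ i m = if m ≤ᵇ i then m else m ∸ 1

-- Nice xs : xs can be transformed into [2] (i.e. 1 ↦ 2) by a finite
-- sequence of reductions.  Position i (1-based) is  suc (length ys)
-- when xs = ys ++ f(i) ∷ zs.
data Nice : List ℕ → Set where
  base  : Nice (2 ∷ [])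
  type1 : (ys zs : List ℕ) →
          Nice (map (ψ (suc (length ys))) (ys ++ zs)) →
          Nice (ys ++ suc (length ys) ∷ zs)
  type2 : (ys zs : List ℕ) →
          -- k ≥ 2, i.e. the reduced bijection has nonempty domain
          1 Data.Nat.≤ length (ys ++ zs) →
          Nice (map (φ (suc (length ys))) (ys ++ zs)) →
          Nice (ys ++ suc (suc (length ys)) ∷ zs)

NiceBijCount : ℕ → ℕ → Set
NiceBijCount k c =
  Σ (List (List ℕ)) λ L →
    Unique L × ((xs : List ℕ) → (xs ∈ L) ⇔ (IsBij k xs × Nice xs)) × length L ≡ c

Seq-a : ℕ → ℕ → Set
Seq-a zero c = ⊤
Seq-a (suc zero) c = c ≡ 1
Seq-a (suc (suc k)) c = NiceBijCount (suc k) c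

module Submission where

-- The
-- central notion is that of a tree bijection (Tree n xs), built from a binary
-- tree with n internal nodes: a node lists its left block, then a new maximal
-- value, then its right block relabelled by graft.  The argument has three parts.
--  1. Tree bijections are bijections, and those of size ≥ 1 are nice: every
--     node of size ≥ 2 reduces in one step to a tree bijection of one size
--     less (reduce-node, using that reductions commute with embedding a block).
--  2. Every nice bijection is a tree bijection, since undoing a reduction,
--     i.e. inserting a value, preserves tree bijections (tree-insert).
--  3. Forests of h+1 trees with m nodes are enumerated without repetition
--     (forests); their number satisfies the ballot recursion, whose closed form
--     (h+1)(h+2m)!/(m!(h+m+1)!) gives C_n one-tree forests of size n.

open import Defs
open import Data.Nat using (ℕ; _≤_; _∸_)

open import Data.Nat using (zero; suc; _+_; _*_; _/_; _<_; _!; _≤ᵇ_; _≡ᵇ_; z≤n; s≤s; NonZero; _≟_; _≤?_; _<?_)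
open import Data.Nat.Properties
open import Data.Nat.DivMod using (m*n/n≡m)
open import Data.Nat.Induction using (<-rec)
open import Data.Nat.Solver using (module +-*-Solver)
open import Data.Bool using (Bool; true; false; T; if_then_else_)
open import Data.Empty using (⊥-elim)
open import Data.Product using (Σ; _×_; _,_; proj₁; proj₂)
open import Data.Sum using (_⊎_; inj₁; inj₂; [_,_]′)
open import Data.List using (List; []; _∷_; _++_; map; length; replicate; upTo)
open import Data.Nat.ListAction using (sum)
open import Data.List.Properties using (length-++; length-map; map-++; ++-assoc; map-id; map-∘; map-cong-local; ∷-injective; length-upTo; length-++-≤ˡ; length-++-≤ʳ)
open import Data.List.Relation.Unary.All as All using (All; []; _∷_)
import Data.List.Relation.Unary.All.Properties as AllP
open import Data.List.Relation.Unary.Any using (here; there)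
open import Data.List.Relation.Unary.AllPairs using ([]; _∷_)
open import Data.List.Relation.Unary.Unique.Propositional using (Unique)
import Data.List.Relation.Unary.Unique.Propositional.Properties as UniqueP
open import Data.List.Membership.Propositional using (_∈_)
open import Data.List.Membership.Propositional.Properties using (∈-map⁺; ∈-map⁻; ∈-upTo⁺; ∈-upTo⁻; ∈-∃++; ∈-++⁺ˡ; ∈-++⁺ʳ; ∈-++⁻)
open import Data.List.Relation.Binary.Permutation.Propositional as ↭ using (_↭_; prep; swap; ↭-sym)
open import Data.List.Relation.Binary.Permutation.Propositional.Properties using (All-resp-↭; ↭-length; shift)
open import Function.Bundles using (_⇔_; mk⇔)
import Function.Properties.Equivalence as ⇔
open import Relation.Nullary using (¬_; yes; no)
open import Relation.Binary.PropositionalEquality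
open import Relation.Binary.Definitions using (tri<; tri≈; tri>)

open +-*-Solver

map-fuse : ∀ {A B C : Set} {f : B → C} {g : A → B} {h : A → C} {xs} → All (λ x → f (g x) ≡ h x) xs → map f (map g xs) ≡ map h xs
map-fuse {xs = xs} eqs = trans (sym (map-∘ xs)) (map-cong-local eqs)

map-fuse₃ : ∀ {A B C D : Set} {f : C → D} {g : B → C} {k : A → B} {h : A → D} {xs} → All (λ x → f (g (k x)) ≡ h x) xs → map f (map g (map k xs)) ≡ map h xs
map-fuse₃ {xs = xs} eqs = trans (cong (map _) (sym (map-∘ xs))) (map-fuse eqs)

length-mid : ∀ {A : Set} (ys : List A) x zs → length (ys ++ x ∷ zs) ≡ suc (length (ys ++ zs))
length-mid [] x zs = refl
length-mid (y ∷ ys) x zs = cong suc (length-mid ys x zs)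

All-mid : ∀ {A : Set} {P : A → Set} ys {x zs} → All P (ys ++ x ∷ zs) → P x × All P (ys ++ zs)
All-mid [] (px ∷ pzs) = px , pzs
All-mid (y ∷ ys) (py ∷ ps) = proj₁ (All-mid ys ps) , py ∷ proj₂ (All-mid ys ps)

prefix<length : ∀ {A : Set} (ys : List A) {v : A} zs → length ys < length (ys ++ v ∷ zs)
prefix<length ys {v} zs = subst (length ys <_) (sym (length-mid ys v zs)) (s≤s (length-++-≤ˡ ys))

∈-map-elim : ∀ {A B : Set} {Q : B → Set} (f : A → B) {L} → (∀ {x} → x ∈ L → Q (f x)) → ∀ {y} → y ∈ map f L → Q y
∈-map-elim f q y∈ with ∈-map⁻ f y∈
... | x , x∈ , refl = q x∈

mid∈ : ∀ {A : Set} (xs ys : List A) {x R R′} → length xs < length ys → xs ++ x ∷ R ≡ ys ++ R′ → x ∈ ys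
mid∈ [] (y ∷ ys) _ eq = here (proj₁ (∷-injective eq))
mid∈ (_ ∷ xs) (y ∷ ys) (s≤s lt) eq = there (mid∈ xs ys lt (proj₂ (∷-injective eq)))

++-split : ∀ {A : Set} (xs ys : List A) {R R′ : List A} → length xs ≡ length ys → xs ++ R ≡ ys ++ R′ → xs ≡ ys × R ≡ R′
++-split [] [] _ eq = refl , eq
++-split (x ∷ xs) (y ∷ ys) len eq with ∷-injective eq
... | refl , eq′ with ++-split xs ys (suc-injective len) eq′
...   | refl , eq″ = refl , eq″

map-injective-on : ∀ {A B : Set} {P : A → Set} (f : A → B) → (∀ {x y} → P x → P y → f x ≡ f y → x ≡ y) →
                   ∀ {xs ys} → All P xs → All P ys → map f xs ≡ map f ys → xs ≡ ys
map-injective-on f inj [] [] eq = refl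
map-injective-on f inj (px ∷ pxs) (py ∷ pys) eq =
  cong₂ _∷_ (inj px py (proj₁ (∷-injective eq))) (map-injective-on f inj pxs pys (proj₂ (∷-injective eq)))

unique-map-on : ∀ {A B : Set} {P : A → Set} (f : A → B) → (∀ {x y} → P x → P y → f x ≡ f y → x ≡ y) →
                ∀ {xs} → All P xs → Unique xs → Unique (map f xs)
unique-map-on f inj [] [] = []
unique-map-on {P = P} f inj (px ∷ pxs) (x∉ ∷ u) = AllP.map⁺ (distinct pxs x∉) ∷ unique-map-on f inj pxs u
  where
  distinct : ∀ {ys} → All P ys → All (λ y → _ ≢ y) ys → All (λ y → f _ ≢ f y) ys
  distinct [] [] = []
  distinct (py ∷ pys) (x≢y ∷ x≢ys) = (λ e → x≢y (inj px py e)) ∷ distinct pys x≢ys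

unique-mid : ∀ {A : Set} (ys : List A) {x zs} → Unique (ys ++ x ∷ zs) → All (_≢ x) (ys ++ zs) × Unique (ys ++ zs)
unique-mid [] (x∉ ∷ u) = All.map (λ x≢ e → x≢ (sym e)) x∉ , u
unique-mid (y ∷ ys) (y∉ ∷ u) =
  proj₁ (All-mid ys y∉) ∷ proj₁ (unique-mid ys u) , proj₂ (All-mid ys y∉) ∷ proj₂ (unique-mid ys u)

unique-resp-↭ : ∀ {A : Set} {xs ys : List A} → xs ↭ ys → Unique xs → Unique ys
unique-resp-↭ ↭.refl u = u
unique-resp-↭ (prep x p) (x∉ ∷ u) = All-resp-↭ p x∉ ∷ unique-resp-↭ p u
unique-resp-↭ (swap x y p) ((x≢y ∷ x∉) ∷ y∉ ∷ u) =
  ((λ e → x≢y (sym e)) ∷ All-resp-↭ p y∉) ∷ All-resp-↭ p x∉ ∷ unique-resp-↭ p u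
unique-resp-↭ (↭.trans p q) u = unique-resp-↭ q (unique-resp-↭ p u)

∈-delete : ∀ {A : Set} (us : List A) {x vs y} → y ∈ us ++ x ∷ vs → y ≢ x → y ∈ us ++ vs
∈-delete [] (here e) y≢x = ⊥-elim (y≢x e)
∈-delete [] (there y∈) y≢x = y∈
∈-delete (u ∷ us) (here e) y≢x = here e
∈-delete (u ∷ us) (there y∈) y≢x = there (∈-delete us y∈ y≢x)

unique⇒↭ : ∀ {A : Set} {xs ys : List A} → Unique xs → All (_∈ ys) xs → length xs ≡ length ys → xs ↭ ys
unique⇒↭ {xs = []} {[]} _ _ _ = ↭.refl
unique⇒↭ {xs = x ∷ xs} {ys} (x∉ ∷ u) (x∈ ∷ xs⊆) len with ∈-∃++ x∈
... | us , vs , refl = ↭.trans (prep x (unique⇒↭ u xs⊆′ len′)) (↭-sym (shift x us vs))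
  where
  xs⊆′ : All (_∈ us ++ vs) xs
  xs⊆′ = All.zipWith (λ (y∈ , x≢y) → ∈-delete us y∈ (λ e → x≢y (sym e))) (xs⊆ , x∉)
  len′ : length xs ≡ length (us ++ vs)
  len′ = suc-injective (trans len (length-mid us x vs))

insert-at : ∀ {A : Set} → ℕ → A → List A → List A
insert-at zero v xs = v ∷ xs
insert-at (suc p) v [] = v ∷ []
insert-at (suc p) v (x ∷ xs) = x ∷ insert-at p v xs

insert-at-++ˡ : ∀ {A : Set} p (v : A) (X Y : List A) → p ≤ length X → insert-at p v (X ++ Y) ≡ insert-at p v X ++ Y
insert-at-++ˡ zero v X Y _ = refl
insert-at-++ˡ (suc p) v (x ∷ X) Y (s≤s p≤) = cong (x ∷_) (insert-at-++ˡ p v X Y p≤)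

insert-at-++ʳ : ∀ {A : Set} q (v : A) (X : List A) y Y {L} → length X ≡ L → insert-at (suc (L + q)) v (X ++ y ∷ Y) ≡ X ++ y ∷ insert-at q v Y
insert-at-++ʳ q v [] y Y refl = refl
insert-at-++ʳ q v (x ∷ X) y Y refl = cong (x ∷_) (insert-at-++ʳ q v X y Y refl)

insert-at-end : ∀ {A : Set} (v : A) (X : List A) {L} → length X ≡ L → insert-at L v X ≡ X ++ v ∷ []
insert-at-end v [] refl = refl
insert-at-end v (x ∷ X) refl = cong (x ∷_) (insert-at-end v X refl)

insert-at-mid : ∀ {A : Set} (ys : List A) x zs → insert-at (length ys) x (ys ++ zs) ≡ ys ++ x ∷ zs
insert-at-mid [] x zs = refl
insert-at-mid (y ∷ ys) x zs = cong (y ∷_) (insert-at-mid ys x zs)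

map-insert-at : ∀ {A B : Set} (f : A → B) p v X → map f (insert-at p v X) ≡ insert-at p (f v) (map f X)
map-insert-at f zero v X = refl
map-insert-at f (suc p) v [] = refl
map-insert-at f (suc p) v (x ∷ X) = cong (f x ∷_) (map-insert-at f p v X)

-- ballot h m : the number of sequences of h+1 binary trees with m internal
-- nodes in total.  Splitting off the first tree (empty, or a root with two
-- subtrees) gives the recursion below.
ballot : ℕ → ℕ → ℕ
ballot h zero = 1
ballot zero (suc m) = ballot 1 m
ballot (suc h) (suc m) = ballot h (suc m) + ballot (suc (suc h)) m

-- The arithmetic core of the inductive step of ballot-closed, with the
-- factorials m!, (h+m+2)! and (h+2m+2)! abstracted to P, G and F.
ballot-closed-step : ∀ h m x y P G F →
  x * ((suc m * P) * G) ≡ suc h * F →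
  y * (P * ((3 + (h + m)) * G)) ≡ (3 + h) * F →
  (x + y) * ((suc m * P) * ((3 + (h + m)) * G)) ≡ (2 + h) * ((3 + (h + (m + m))) * F)
ballot-closed-step h m x y P G F eqx eqy = begin
    (x + y) * ((suc m * P) * (t * G))
  ≡⟨ solve 6 (λ x y s p t g → (x :+ y) :* ((s :* p) :* (t :* g))
                := t :* (x :* ((s :* p) :* g)) :+ s :* (y :* (p :* (t :* g))))
           refl x y (suc m) P t G ⟩
    t * (x * ((suc m * P) * G)) + suc m * (y * (P * (t * G)))
  ≡⟨ cong₂ (λ u v → t * u + suc m * v) eqx eqy ⟩
    t * (suc h * F) + suc m * ((3 + h) * F)
  ≡⟨ solve 3 (λ h m f → (con 3 :+ (h :+ m)) :* ((con 1 :+ h) :* f) :+ (con 1 :+ m) :* ((con 3 :+ h) :* f)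
                := (con 2 :+ h) :* ((con 3 :+ (h :+ (m :+ m))) :* f))
           refl h m F ⟩
    (2 + h) * ((3 + (h + (m + m))) * F)
  ∎
  where
  open ≡-Reasoning
  t : ℕ
  t = 3 + (h + m)

ballot-closed-succ : ∀ h m →
  ballot h (suc m) * ((suc m) ! * (suc (h + suc m)) !) ≡ suc h * (h + (suc m + suc m)) ! →
  ballot (suc (suc h)) m * (m ! * (suc (suc (suc h) + m)) !) ≡ suc (suc (suc h)) * (suc (suc h) + (m + m)) ! →
  ballot (suc h) (suc m) * ((suc m) ! * (suc (suc h + suc m)) !) ≡ suc (suc h) * (suc h + (suc m + suc m)) !
ballot-closed-succ h m ih₁ ih₂ = begin
    ballot (suc h) (suc m) * ((suc m) ! * (suc (suc h + suc m)) !)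
  ≡⟨ cong (λ k → ballot (suc h) (suc m) * ((suc m) ! * (suc (suc k)) !)) (+-suc h m) ⟩
    (x + y) * ((suc m * m !) * ((3 + (h + m)) * G))
  ≡⟨ ballot-closed-step h m x y (m !) G F eqx ih₂ ⟩
    (2 + h) * ((3 + (h + (m + m))) * F)
  ≡⟨ cong (λ k → suc (suc h) * (suc k) !) (sym index) ⟩
    suc (suc h) * (suc h + (suc m + suc m)) !
  ∎
  where
  open ≡-Reasoning
  x : ℕ
  x = ballot h (suc m)
  y : ℕ
  y = ballot (suc (suc h)) m
  G : ℕ
  G = (suc (suc (h + m))) !
  F : ℕ
  F = (suc (suc (h + (m + m)))) !
  index : h + (suc m + suc m) ≡ suc (suc (h + (m + m)))
  index = begin
      h + suc (m + suc m)    ≡⟨ +-suc h (m + suc m) ⟩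
      suc (h + (m + suc m))  ≡⟨ cong (λ k → suc (h + k)) (+-suc m m) ⟩
      suc (h + suc (m + m))  ≡⟨ cong suc (+-suc h (m + m)) ⟩
      suc (suc (h + (m + m))) ∎
  eqx : x * ((suc m * m !) * G) ≡ suc h * F
  eqx = subst₂ (λ i j → x * ((suc m) ! * (suc i) !) ≡ suc h * j !) (+-suc h m) index ih₁

ballot-closed : ∀ h m → ballot h m * (m ! * (suc (h + m)) !) ≡ suc h * (h + (m + m)) !
ballot-closed h zero rewrite +-identityʳ h =
  solve 2 (λ h f → con 1 :* (con 1 :* ((con 1 :+ h) :* f)) := (con 1 :+ h) :* f) refl h (h !)
ballot-closed zero (suc m) = begin
    ballot 1 m * ((suc m * m !) * (suc (suc m) * suc m !))
  ≡⟨ solve 4 (λ q s p g → q :* ((s :* p) :* g) := s :* (q :* (p :* g)))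
           refl (ballot 1 m) (suc m) (m !) (suc (suc m) * suc m !) ⟩
    suc m * (ballot 1 m * (m ! * (suc (suc m) * suc m !)))
  ≡⟨ cong (suc m *_) (ballot-closed 1 m) ⟩
    suc m * (2 * (suc (m + m)) !)
  ≡⟨ solve 2 (λ m f → (con 1 :+ m) :* (con 2 :* f) := con 1 :* ((con 2 :+ (m :+ m)) :* f))
           refl m ((suc (m + m)) !) ⟩
    1 * (suc (suc (m + m)) * (suc (m + m)) !)
  ≡⟨ cong (λ k → 1 * (suc k) !) (sym (+-suc m m)) ⟩
    1 * (suc m + suc m) !
  ∎
  where open ≡-Reasoning
ballot-closed (suc h) (suc m) =
  ballot-closed-succ h m (ballot-closed h (suc m)) (ballot-closed (suc (suc h)) m)

catalan≡ballot : ∀ m → catalan m ≡ ballot 0 m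
catalan≡ballot m = begin
    (2 * m) ! / (m ! * (suc m) !)
  ≡⟨ cong (λ k → k ! / (m ! * (suc m) !)) (cong (m +_) (+-identityʳ m)) ⟩
    (m + m) ! / (m ! * (suc m) !)
  ≡⟨ cong (_/ (m ! * (suc m) !)) (sym (trans (ballot-closed 0 m) (+-identityʳ _))) ⟩
    (ballot 0 m * (m ! * (suc m) !)) / (m ! * (suc m) !)
  ≡⟨ m*n/n≡m (ballot 0 m) (m ! * (suc m) !) ⟩
    ballot 0 m
  ∎
  where
  open ≡-Reasoning
  instance
    factorials≢0 : NonZero (m ! * (suc m) !)
    factorials≢0 = m !* suc m !≢0

if-true : ∀ {A : Set} {b : Bool} {x y : A} → T b → (if b then x else y) ≡ x
if-true {b = true} _ = refl

if-false : ∀ {A : Set} {b : Bool} {x y : A} → ¬ T b → (if b then x else y) ≡ y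
if-false {b = true} ¬b = ⊥-elim (¬b _)
if-false {b = false} _ = refl

ψ-below : ∀ {i m} → m < i → ψ i m ≡ m
ψ-below m<i = if-true (≤⇒≤ᵇ m<i)

ψ-above : ∀ {i m} → i ≤ m → ψ i m ≡ m ∸ 1
ψ-above {i} {m} i≤m = if-false (λ t → <⇒≱ (≤ᵇ⇒≤ (suc m) i t) i≤m)

φ-below : ∀ {i m} → m ≤ i → φ i m ≡ m
φ-below m≤i = if-true (≤⇒≤ᵇ m≤i)

φ-above : ∀ {i m} → i < m → φ i m ≡ m ∸ 1
φ-above {i} {m} i<m = if-false (λ t → <⇒≱ i<m (≤ᵇ⇒≤ m i t))

-- raise v makes room for a new value v: values ≥ v move up by one.  It
-- inverts ψ and φ on the values that survive a reduction.
raise : ℕ → ℕ → ℕ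
raise v m = if suc m ≤ᵇ v then m else suc m

raise-below : ∀ {v m} → m < v → raise v m ≡ m
raise-below m<v = if-true (≤⇒≤ᵇ m<v)

raise-above : ∀ {v m} → v ≤ m → raise v m ≡ suc m
raise-above {v} {m} v≤m = if-false (λ t → <⇒≱ (≤ᵇ⇒≤ (suc m) v t) v≤m)

InRange : ℕ → ℕ → Set
InRange k v = 2 ≤ v × v ≤ suc k

-- graft a b relabels the values 2,…,b+1 of a block of length b placed
-- after a block of length a and one further position: the top value b+1
-- becomes a+2 and every other value w becomes a+w+1.
graft : ℕ → ℕ → ℕ → ℕ
graft a b w = if w ≡ᵇ suc b then suc (suc a) else suc (a + w)

graft-top : ∀ a b → graft a b (suc b) ≡ suc (suc a)
graft-top a b = if-true (≡⇒≡ᵇ (suc b) (suc b) refl)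

graft-shift : ∀ a b {w} → w ≢ suc b → graft a b w ≡ suc (a + w)
graft-shift a b {w} w≢top = if-false (λ t → w≢top (≡ᵇ⇒≡ w (suc b) t))

a<a+b : ∀ a {b} → 1 ≤ b → a < a + b
a<a+b a 1≤b = ≤-trans (≤-reflexive (+-comm 1 a)) (+-monoʳ-≤ a 1≤b)

top≢shift : ∀ {a y} → 2 ≤ y → suc (suc a) ≢ suc (a + y)
top≢shift {a} 2≤y e = <⇒≢ (≤-trans (≤-reflexive (+-comm 2 a)) (+-monoʳ-≤ a 2≤y)) (suc-injective e)

graft-range : ∀ a b {w} → InRange b w → suc (suc a) ≤ graft a b w × graft a b w ≤ suc (a + b)
graft-range a b {w} (lo , hi) with w ≟ suc b
... | yes refl rewrite graft-top a b = ≤-refl , s≤s (a<a+b a (≤-pred lo))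
... | no w≢top rewrite graft-shift a b w≢top =
  s≤s (a<a+b a (≤-trans (s≤s z≤n) lo)) , s≤s (+-monoʳ-≤ a (≤-pred (≤∧≢⇒< hi w≢top)))

graft-suc : ∀ a b w → graft (suc a) b w ≡ suc (graft a b w)
graft-suc a b w with w ≟ suc b
... | yes refl rewrite graft-top (suc a) b | graft-top a b = refl
... | no w≢top rewrite graft-shift (suc a) b w≢top | graft-shift a b w≢top = refl

graft-injective : ∀ a b {x y} → InRange b x → InRange b y → graft a b x ≡ graft a b y → x ≡ y
graft-injective a b {x} {y} (lx , _) (ly , _) e with x ≟ suc b | y ≟ suc b
... | yes refl | yes refl = refl
... | yes refl | no y≢top rewrite graft-top a b | graft-shift a b y≢top =
  ⊥-elim (top≢shift ly e)
... | no x≢top | yes refl rewrite graft-top a b | graft-shift a b x≢top =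
  ⊥-elim (top≢shift lx (sym e))
... | no x≢top | no y≢top rewrite graft-shift a b x≢top | graft-shift a b y≢top =
  +-cancelˡ-≡ a x y (suc-injective e)

node-list : ℕ → ℕ → List ℕ → List ℕ → List ℕ
node-list a b A B = A ++ suc (suc (a + b)) ∷ map (graft a b) B

data Tree : ℕ → List ℕ → Set where
  leaf : Tree 0 []
  node : ∀ {a b A B} → Tree a A → Tree b B →
         Tree (suc (a + b)) (node-list a b A B)

Tree-cong : ∀ {n m xs ys} → n ≡ m → xs ≡ ys → Tree n xs → Tree m ys
Tree-cong refl refl t = t

tree-length : ∀ {n xs} → Tree n xs → length xs ≡ n
tree-length leaf = refl
tree-length (node {a} {b} {A} {B} tA tB) = begin
    length (A ++ _ ∷ map (graft a b) B)
  ≡⟨ length-++ A ⟩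
    length A + suc (length (map (graft a b) B))
  ≡⟨ cong₂ (λ x y → x + suc y) (tree-length tA) (trans (length-map (graft a b) B) (tree-length tB)) ⟩
    a + suc b
  ≡⟨ +-suc a b ⟩
    suc (a + b)
  ∎
  where open ≡-Reasoning

tree-range : ∀ {n xs} → Tree n xs → All (InRange n) xs
tree-range leaf = []
tree-range (node {a} {b} tA tB) =
  AllP.++⁺ (All.map left (tree-range tA))
           ((s≤s (s≤s z≤n) , ≤-refl) ∷ AllP.map⁺ (All.map right (tree-range tB)))
  where
  left : ∀ {v} → InRange a v → InRange (suc (a + b)) v
  left (lo , hi) = lo , ≤-trans hi (s≤s (≤-trans (m≤m+n a b) (n≤1+n _)))
  right : ∀ {w} → InRange b w → InRange (suc (a + b)) (graft a b w)
  right r = ≤-trans (s≤s (s≤s z≤n)) (proj₁ (graft-range a b r)) , ≤-trans (proj₂ (graft-range a b r)) (n≤1+n _)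

tree-range′ : ∀ {a A} → Tree a A → All (InRange (length A)) A
tree-range′ {A = A} tA = subst (λ k → All (InRange k) A) (sym (tree-length tA)) (tree-range tA)

-- In a node, the left block lies below a+2 and the rest at or above it.
tree-unique : ∀ {n xs} → Tree n xs → Unique xs
tree-unique leaf = []
tree-unique (node {a} {b} {A} {B} tA tB) =
  UniqueP.++⁺ (tree-unique tA)
    (AllP.map⁺ (All.map (λ r e → <⇒≢ (s≤s (proj₂ (graft-range a b r))) (sym e)) (tree-range tB))
      ∷ unique-map-on (graft a b) (graft-injective a b) (tree-range tB) (tree-unique tB))
    disjoint
  where
  high : All (λ v → suc (suc a) ≤ v) (suc (suc (a + b)) ∷ map (graft a b) B)
  high = s≤s (s≤s (m≤m+n a b)) ∷ AllP.map⁺ (All.map (λ r → proj₁ (graft-range a b r)) (tree-range tB))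
  disjoint : ∀ {v} → ¬ (v ∈ A × v ∈ (suc (suc (a + b)) ∷ map (graft a b) B))
  disjoint (v∈A , v∈rest) = <⇒≱ (s≤s (proj₂ (All.lookup (tree-range tA) v∈A))) (All.lookup high v∈rest)

Bij : ℕ → List ℕ → Set
Bij k xs = Unique xs × All (InRange k) xs × length xs ≡ k

codomain : ℕ → List ℕ
codomain k = map (λ j → 2 + j) (upTo k)

isBij⇒bij : ∀ {k xs} → IsBij k xs → Bij k xs
isBij⇒bij {k} p =
  unique-resp-↭ (↭-sym p) (UniqueP.map⁺ (λ {x} {y} → +-cancelˡ-≡ 2 x y) (UniqueP.upTo⁺ k)) ,
  All-resp-↭ (↭-sym p) (AllP.map⁺ (All.tabulate (λ j∈ → s≤s (s≤s z≤n) , s≤s (∈-upTo⁻ j∈)))) ,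
  trans (↭-length p) (trans (length-map _ (upTo k)) (length-upTo k))

tree⇒isBij : ∀ {n xs} → Tree n xs → IsBij n xs
tree⇒isBij {n} t =
  unique⇒↭ (tree-unique t) (All.map ∈-codomain (tree-range t))
    (trans (tree-length t) (sym (trans (length-map _ (upTo n)) (length-upTo n))))
  where
  ∈-codomain : ∀ {v} → InRange n v → v ∈ codomain n
  ∈-codomain {suc (suc v)} (s≤s (s≤s z≤n) , s≤s v<n) = ∈-map⁺ (λ j → 2 + j) (∈-upTo⁺ v<n)

data _⟶_ : List ℕ → List ℕ → Set where
  reduce₁ : ∀ ys zs → (ys ++ suc (length ys) ∷ zs) ⟶ map (ψ (suc (length ys))) (ys ++ zs)
  reduce₂ : ∀ ys zs → 1 ≤ length (ys ++ zs) →
            (ys ++ suc (suc (length ys)) ∷ zs) ⟶ map (φ (suc (length ys))) (ys ++ zs)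

⟶-cong : ∀ {xs xs′ ys ys′} → xs ≡ xs′ → ys ≡ ys′ → xs ⟶ ys → xs′ ⟶ ys′
⟶-cong refl refl r = r

nice-backwards : ∀ {xs ys} → xs ⟶ ys → Nice ys → Nice xs
nice-backwards (reduce₁ ys zs) n = type1 ys zs n
nice-backwards (reduce₂ ys zs p) n = type2 ys zs p n

-- A value outside the block {d+2,…,d+a+1} occupied by an embedded block of
-- length a placed after d positions.
Outside : ℕ → ℕ → ℕ → Set
Outside d a v = v ≤ suc d ⊎ suc (suc (d + a)) ≤ v

ψ-outside : ∀ {d a y v} → 1 ≤ y → y < a → Outside d a v → ψ (suc (d + y)) v ≡ φ (suc d) v
ψ-outside {d} 1≤y y<a (inj₁ low) =
  trans (ψ-below (s≤s (≤-trans low (≤-trans (≤-reflexive (+-comm 1 d)) (+-monoʳ-≤ d 1≤y))))) (sym (φ-below low))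
ψ-outside {d} {a} {y} 1≤y y<a (inj₂ high) =
  trans (ψ-above (≤-trans (s≤s (+-monoʳ-≤ d (≤-trans (n≤1+n y) y<a))) (≤-trans (n≤1+n _) high)))
        (sym (φ-above (≤-trans (s≤s (s≤s (m≤m+n d a))) high)))

φ-outside : ∀ {d a y v} → y < a → Outside d a v → φ (suc (d + y)) v ≡ φ (suc d) v
φ-outside {d} {y = y} y<a (inj₁ low) = trans (φ-below (≤-trans low (s≤s (m≤m+n d y)))) (sym (φ-below low))
φ-outside {d} {a} {y} y<a (inj₂ high) =
  trans (φ-above (≤-trans (s≤s (s≤s (+-monoʳ-≤ d (≤-trans (n≤1+n y) y<a)))) high))
        (sym (φ-above (≤-trans (s≤s (s≤s (m≤m+n d a))) high)))

ψ-inside : ∀ {d y w} → 1 ≤ w → ψ (suc (d + y)) (d + w) ≡ d + ψ (suc y) w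
ψ-inside {d} {y} {w} 1≤w with w <? suc y
... | yes w≤y =
  trans (ψ-below (≤-trans (≤-reflexive (sym (+-suc d w))) (≤-trans (+-monoʳ-≤ d w≤y) (≤-reflexive (+-suc d y)))))
        (cong (d +_) (sym (ψ-below w≤y)))
... | no w≰y =
  trans (ψ-above (≤-trans (≤-reflexive (sym (+-suc d y))) (+-monoʳ-≤ d (≮⇒≥ w≰y))))
        (trans (+-∸-assoc d 1≤w) (cong (d +_) (sym (ψ-above (≮⇒≥ w≰y)))))

φ-inside : ∀ {d y w} → 1 ≤ w → φ (suc (d + y)) (d + w) ≡ d + φ (suc y) w
φ-inside {d} {y} {w} 1≤w with w ≤? suc y
... | yes w≤y+1 =
  trans (φ-below (≤-trans (+-monoʳ-≤ d w≤y+1) (≤-reflexive (+-suc d y))))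
        (cong (d +_) (sym (φ-below w≤y+1)))
... | no w≰y+1 =
  trans (φ-above (≤-trans (s≤s (≤-reflexive (sym (+-suc d y))))
                          (≤-trans (≤-reflexive (sym (+-suc d (suc y)))) (+-monoʳ-≤ d (≰⇒> w≰y+1)))))
        (trans (+-∸-assoc d 1≤w) (cong (d +_) (sym (φ-above (≰⇒> w≰y+1)))))

position : ∀ k (P ys : List ℕ) → k + length (P ++ map (length P +_) ys) ≡ length P + (k + length ys)
position k P ys = begin
    k + length (P ++ map (length P +_) ys)
  ≡⟨ cong (k +_) (trans (length-++ P) (cong (length P +_) (length-map _ ys))) ⟩
    k + (length P + length ys)
  ≡⟨ solve 3 (λ k d y → k :+ (d :+ y) := d :+ (k :+ y)) refl k (length P) (length ys) ⟩
    length P + (k + length ys)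
  ∎
  where open ≡-Reasoning

embedded-length : ∀ (f : ℕ → ℕ) (P ys zs S : List ℕ) → length (ys ++ zs) ≤ length ((P ++ map f ys) ++ (map f zs ++ S))
embedded-length f P ys zs S = begin
    length (ys ++ zs)
  ≡⟨ length-++ ys ⟩
    length ys + length zs
  ≤⟨ +-mono-≤ (≤-trans (≤-reflexive (sym (length-map f ys))) (length-++-≤ʳ (map f ys) {P}))
              (≤-trans (≤-reflexive (sym (length-map f zs))) (length-++-≤ˡ (map f zs))) ⟩
    length (P ++ map f ys) + length (map f zs ++ S)
  ≡⟨ sym (length-++ (P ++ map f ys)) ⟩
    length ((P ++ map f ys) ++ (map f zs ++ S))
  ∎
  where open ≤-Reasoning

embedded-source : ∀ (P ys zs S : List ℕ) v →
  (P ++ map (length P +_) ys) ++ (length P + v) ∷ (map (length P +_) zs ++ S) ≡ P ++ map (length P +_) (ys ++ v ∷ zs) ++ S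
embedded-source P ys zs S v = begin
    (P ++ map d+ ys) ++ (d + v) ∷ (map d+ zs ++ S)
  ≡⟨ ++-assoc P _ _ ⟩
    P ++ map d+ ys ++ (d + v) ∷ (map d+ zs ++ S)
  ≡⟨ cong (P ++_) (sym (++-assoc (map d+ ys) _ S)) ⟩
    P ++ (map d+ ys ++ map d+ (v ∷ zs)) ++ S
  ≡⟨ cong (λ l → P ++ l ++ S) (sym (map-++ d+ ys (v ∷ zs))) ⟩
    P ++ map d+ (ys ++ v ∷ zs) ++ S
  ∎
  where
  open ≡-Reasoning
  d : ℕ
  d = length P
  d+ : ℕ → ℕ
  d+ = d +_

embedded-target : ∀ (R F R′ : ℕ → ℕ) (P ys zs S : List ℕ) →
  All (λ v → R v ≡ F v) P → All (λ v → R v ≡ F v) S →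
  All (λ w → R (length P + w) ≡ length P + R′ w) (ys ++ zs) →
  map R ((P ++ map (length P +_) ys) ++ (map (length P +_) zs ++ S))
    ≡ map F P ++ map (length P +_) (map R′ (ys ++ zs)) ++ map F S
embedded-target R F R′ P ys zs S onP onS inside = begin
    map R ((P ++ map d+ ys) ++ (map d+ zs ++ S))
  ≡⟨ cong (map R) (++-assoc P _ _) ⟩
    map R (P ++ (map d+ ys ++ map d+ zs ++ S))
  ≡⟨ cong (λ l → map R (P ++ l)) (sym (++-assoc (map d+ ys) _ S)) ⟩
    map R (P ++ (map d+ ys ++ map d+ zs) ++ S)
  ≡⟨ cong (λ l → map R (P ++ l ++ S)) (sym (map-++ d+ ys zs)) ⟩
    map R (P ++ map d+ (ys ++ zs) ++ S)
  ≡⟨ map-++ R P _ ⟩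
    map R P ++ map R (map d+ (ys ++ zs) ++ S)
  ≡⟨ cong (map R P ++_) (map-++ R (map d+ (ys ++ zs)) S) ⟩
    map R P ++ map R (map d+ (ys ++ zs)) ++ map R S
  ≡⟨ cong₂ (λ l r → l ++ map R (map d+ (ys ++ zs)) ++ r) (map-cong-local onP) (map-cong-local onS) ⟩
    map F P ++ map R (map d+ (ys ++ zs)) ++ map F S
  ≡⟨ cong (λ l → map F P ++ l ++ map F S) (trans (map-fuse inside) (map-∘ (ys ++ zs))) ⟩
    map F P ++ map d+ (map R′ (ys ++ zs)) ++ map F S
  ∎
  where
  open ≡-Reasoning
  d+ : ℕ → ℕ
  d+ = length P +_

embed-reduction : ∀ {A A′} (P S : List ℕ) → A ⟶ A′ → All (InRange (length A)) A →
  All (Outside (length P) (length A)) (P ++ S) →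
  (P ++ map (length P +_) A ++ S) ⟶ (map (φ (suc (length P))) P ++ map (length P +_) A′ ++ map (φ (suc (length P))) S)
embed-reduction P S (reduce₁ ys zs) inA out =
  ⟶-cong (trans (cong (λ v → (P ++ map d+ ys) ++ v ∷ (map d+ zs ++ S)) (position 1 P ys))
                 (embedded-source P ys zs S (suc y)))
          (trans (cong (λ i → map (ψ (suc i)) remaining) (position 0 P ys))
                 (embedded-target (ψ (suc (d + y))) (φ (suc d)) (ψ (suc y)) P ys zs S
                   (All.map outside (proj₁ (AllP.++⁻ P out))) (All.map outside (proj₂ (AllP.++⁻ P out)))
                   (All.map (λ r → ψ-inside (≤-trans (s≤s z≤n) (proj₁ r))) (proj₂ (All-mid ys inA)))))
          (reduce₁ (P ++ map d+ ys) (map d+ zs ++ S))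
  where
  d : ℕ
  d = length P
  y : ℕ
  y = length ys
  d+ : ℕ → ℕ
  d+ = d +_
  remaining : List ℕ
  remaining = (P ++ map d+ ys) ++ (map d+ zs ++ S)
  outside : ∀ {v} → Outside d (length (ys ++ suc y ∷ zs)) v → ψ (suc (d + y)) v ≡ φ (suc d) v
  outside = ψ-outside (≤-pred (proj₁ (proj₁ (All-mid ys inA)))) (prefix<length ys zs)
embed-reduction P S (reduce₂ ys zs 1≤len) inA out =
  ⟶-cong (trans (cong (λ v → (P ++ map d+ ys) ++ v ∷ (map d+ zs ++ S)) (position 2 P ys))
                 (embedded-source P ys zs S (suc (suc y))))
          (trans (cong (λ i → map (φ (suc i)) remaining) (position 0 P ys))
                 (embedded-target (φ (suc (d + y))) (φ (suc d)) (φ (suc y)) P ys zs S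
                   (All.map outside (proj₁ (AllP.++⁻ P out))) (All.map outside (proj₂ (AllP.++⁻ P out)))
                   (All.map (λ r → φ-inside (≤-trans (s≤s z≤n) (proj₁ r))) (proj₂ (All-mid ys inA)))))
          (reduce₂ (P ++ map d+ ys) (map d+ zs ++ S) (≤-trans 1≤len (embedded-length d+ P ys zs S)))
  where
  d : ℕ
  d = length P
  y : ℕ
  y = length ys
  d+ : ℕ → ℕ
  d+ = d +_
  remaining : List ℕ
  remaining = (P ++ map d+ ys) ++ (map d+ zs ++ S)
  outside : ∀ {v} → Outside d (length (ys ++ suc (suc y) ∷ zs)) v → φ (suc (d + y)) v ≡ φ (suc d) v
  outside = φ-outside (prefix<length ys zs)

φ-graft-left : ∀ a b w → φ 1 (graft (suc a) b w) ≡ graft a b w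
φ-graft-left a b w with w ≟ suc b
... | yes refl rewrite graft-top (suc a) b | graft-top a b = φ-above (s≤s (s≤s z≤n))
... | no w≢top rewrite graft-shift (suc a) b {w} w≢top | graft-shift a b {w} w≢top = φ-above (s≤s (s≤s z≤n))

ψ-graft-right : ∀ b w → InRange b w → ψ 2 (graft 0 (suc b) (graft 0 b w)) ≡ graft 0 b w
ψ-graft-right b w (lo , _) with w ≟ suc b
... | yes refl rewrite graft-top 0 b | graft-shift 0 (suc b) {2} (λ e → <⇒≢ (s≤s (s≤s (≤-pred lo))) e) = refl
... | no w≢top rewrite graft-shift 0 b {w} w≢top | graft-shift 0 (suc b) {suc w} (λ e → w≢top (suc-injective e)) =
  ψ-above (s≤s (s≤s z≤n))

φ-graft-right : ∀ a b w → InRange b w →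
  φ 2 (graft 0 (suc (suc (a + b))) (graft (suc a) b w)) ≡ graft 0 (suc (a + b)) (graft a b w)
φ-graft-right a b w (lo , hi) with w ≟ suc b
... | yes refl rewrite graft-top (suc a) b | graft-top a b
        | graft-shift 0 (suc (suc (a + b))) {suc (suc (suc a))} (λ e → <⇒≢ (s≤s (s≤s (s≤s (a<a+b a (≤-pred lo))))) e)
        | graft-shift 0 (suc (a + b)) {suc (suc a)} (λ e → <⇒≢ (s≤s (s≤s (a<a+b a (≤-pred lo)))) e) =
  φ-above (s≤s (s≤s (s≤s z≤n)))
... | no w≢top rewrite graft-shift (suc a) b {w} w≢top | graft-shift a b {w} w≢top
        | graft-shift 0 (suc (suc (a + b))) {suc (suc (a + w))} (λ e → <⇒≢ (s≤s (s≤s (s≤s (+-monoʳ-≤ a (≤-pred (≤∧≢⇒< hi w≢top)))))) e)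
        | graft-shift 0 (suc (a + b)) {suc (a + w)} (λ e → <⇒≢ (s≤s (s≤s (+-monoʳ-≤ a (≤-pred (≤∧≢⇒< hi w≢top))))) e) =
  φ-above (s≤s (s≤s (s≤s z≤n)))

graft-small : ∀ b {xs} → All (λ w → w ≤ b) xs → map (graft 0 b) xs ≡ map suc xs
graft-small b [] = refl
graft-small b {w ∷ _} (w≤b ∷ ws≤b) = cong₂ _∷_ (graft-shift 0 b {w} (λ e → <⇒≢ (s≤s w≤b) e)) (graft-small b ws≤b)

Reduct : List ℕ → ℕ → Set
Reduct xs n = Σ (List ℕ) λ ys → xs ⟶ ys × Tree n ys

reduce-left : ∀ {a b A B} → Tree (suc a) A → Tree b B → Reduct A a →
              Reduct (node-list (suc a) b A B) (suc a + b)
reduce-left {a} {b} {A} {B} tA tB (A′ , r , tA′) =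
  _ , ⟶-cong (cong (_++ S) (map-id A)) target (embed-reduction [] S r (tree-range′ tA) outside) , node tA′ tB
  where
  S : List ℕ
  S = suc (suc (suc a + b)) ∷ map (graft (suc a) b) B
  outside : All (Outside 0 (length A)) S
  outside = subst (λ k → All (Outside 0 k) S) (sym (tree-length tA))
    (inj₂ (s≤s (s≤s (s≤s (m≤m+n a b)))) ∷ AllP.map⁺ (All.map (λ r → inj₂ (proj₁ (graft-range _ _ r))) (tree-range tB)))
  target : map (0 +_) A′ ++ map (φ 1) S ≡ node-list a b A′ B
  target = cong₂ _++_ (map-id A′) (cong₂ _∷_ (φ-above (s≤s (s≤s z≤n))) (map-fuse (All.universal (φ-graft-left a b) B)))

reduce-right-left : ∀ {a b A B} → Tree (suc a) A → Tree b B → Reduct A a →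
  Reduct (node-list 0 (suc (suc a + b)) [] (node-list (suc a) b A B)) (suc (suc (a + b)))
reduce-right-left {a} {b} {A} {B} tA tB (A′ , r , tA′) =
  _ , ⟶-cong source target (embed-reduction (K ∷ []) S r (tree-range′ tA) outside) , node leaf (node tA′ tB)
  where
  n : ℕ
  n = suc (suc a + b)
  K : ℕ
  K = suc (suc n)
  R : List ℕ
  R = map (graft (suc a) b) B
  S : List ℕ
  S = 2 ∷ map (graft 0 n) R
  outside : All (Outside 1 (length A)) ((K ∷ []) ++ S)
  outside = subst (λ k → All (Outside 1 k) ((K ∷ []) ++ S)) (sym (tree-length tA))
    (inj₂ (s≤s (s≤s (s≤s (s≤s (m≤m+n a b))))) ∷ inj₁ ≤-refl ∷
      AllP.map⁺ (AllP.map⁺ (All.map (λ {w} r → inj₂ (≤-trans (s≤s (proj₁ (graft-range _ _ r)))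
        (≤-reflexive (sym (graft-shift 0 n (λ e → <⇒≢ (s≤s (proj₂ (graft-range _ _ r))) e))))))
        (tree-range tB))))
  source : (K ∷ []) ++ map (1 +_) A ++ S ≡ K ∷ map (graft 0 n) (A ++ suc n ∷ R)
  source = cong (K ∷_) (sym (trans (map-++ (graft 0 n) A (suc n ∷ R))
    (cong₂ _++_ (graft-small n (All.map (λ r → ≤-trans (proj₂ r) (s≤s (s≤s (m≤m+n a b)))) (tree-range tA)))
                (cong (_∷ map (graft 0 n) R) (graft-top 0 n)))))
  target : map (φ 2) (K ∷ []) ++ map (1 +_) A′ ++ map (φ 2) S ≡
           suc (suc (suc (a + b))) ∷ map (graft 0 (suc (a + b))) (node-list a b A′ B)
  target = cong₂ _∷_ (φ-above (s≤s (s≤s (s≤s z≤n))))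
    (sym (trans (map-++ (graft 0 (suc (a + b))) A′ _)
      (cong₂ _++_ (graft-small (suc (a + b)) (All.map (λ r → ≤-trans (proj₂ r) (s≤s (m≤m+n a b))) (tree-range tA′)))
        (cong₂ _∷_ (trans (graft-top 0 (suc (a + b))) (sym (φ-below {2} (s≤s (s≤s z≤n)))))
          (sym (trans (map-fuse₃ (All.map (λ {w} r → φ-graft-right a b w r) (tree-range tB))) (map-∘ B)))))))

reduce-first : ∀ {b B} → Tree b B → Reduct (node-list 1 b (2 ∷ []) B) (suc b)
reduce-first {b} {B} tB =
  _ , ⟶-cong refl (cong₂ _∷_ (φ-above (s≤s (s≤s z≤n))) (map-fuse (All.universal (φ-graft-left 0 b) B)))
                 (reduce₂ [] (suc (suc (suc b)) ∷ map (graft 1 b) B) (s≤s z≤n))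
    , node leaf tB

reduce-second-delete : ∀ {b B} → Tree b B → Reduct (node-list 0 (suc b) [] (node-list 0 b [] B)) (suc b)
reduce-second-delete {b} {B} tB =
  _ , ⟶-cong (cong (λ v → K ∷ v ∷ rest) (sym (graft-top 0 (suc b))))
             (cong₂ _∷_ (ψ-above (s≤s (s≤s z≤n))) (map-fuse₃ (All.map (λ {w} r → ψ-graft-right b w r) (tree-range tB))))
             (reduce₁ (K ∷ []) rest)
    , node leaf tB
  where
  K : ℕ
  K = suc (suc (suc b))
  rest : List ℕ
  rest = map (graft 0 (suc b)) (map (graft 0 b) B)

reduce-second-glue : ∀ {b B} → Tree b B → Reduct (node-list 0 (suc (suc b)) [] (node-list 1 b (2 ∷ []) B)) (suc (suc b))
reduce-second-glue {b} {B} tB =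
  _ , ⟶-cong (cong (K ∷_) (cong₂ _∷_ (sym (graft-shift 0 (suc (suc b)) {2} (λ ())))
                                     (cong (_∷ rest) (sym (graft-top 0 (suc (suc b)))))))
             (cong₂ _∷_ (φ-above (s≤s (s≤s (s≤s z≤n))))
               (cong₂ _∷_ (trans (φ-below {2} (s≤s (s≤s z≤n))) (sym (graft-top 0 (suc b))))
                 (trans (map-fuse₃ (All.map (λ {w} r → φ-graft-right 0 b w r) (tree-range tB))) (map-∘ B))))
             (reduce₂ (K ∷ []) (2 ∷ rest) (s≤s z≤n))
    , node leaf (node leaf tB)
  where
  K : ℕ
  K = suc (suc (suc (suc b)))
  rest : List ℕ
  rest = map (graft 0 (suc (suc b))) (map (graft 1 b) B)

-- Every node of size at least two reduces in one step to a tree bijection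
-- of one size less: at the first or second position when the left subtree,
-- or else the left subtree of the right subtree, is [] or [2]; otherwise
-- inside that subtree, by recursion.
reduce-node : ∀ {a b A B} → Tree a A → Tree b B → 1 ≤ a + b → Reduct (node-list a b A B) (a + b)
reduce-node leaf leaf ()
reduce-node (node leaf leaf) tB _ = reduce-first tB
reduce-node tA@(node t₁@(node _ _) t₂) tB _ = reduce-left tA tB (reduce-node t₁ t₂ (s≤s z≤n))
reduce-node tA@(node leaf t₂@(node _ _)) tB _ = reduce-left tA tB (reduce-node leaf t₂ (s≤s z≤n))
reduce-node leaf (node leaf tB) _ = reduce-second-delete tB
reduce-node leaf (node (node leaf leaf) tB) _ = reduce-second-glue tB
reduce-node leaf (node tA@(node t₁@(node _ _) t₂) tB) _ = reduce-right-left tA tB (reduce-node t₁ t₂ (s≤s z≤n))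
reduce-node leaf (node tA@(node leaf t₂@(node _ _)) tB) _ = reduce-right-left tA tB (reduce-node leaf t₂ (s≤s z≤n))

tree⇒nice : ∀ n {xs} → Tree n xs → 1 ≤ n → Nice xs
tree⇒nice = <-rec _ nice-by-size
  where
  from-reduct : ∀ {n xs} → (∀ {m} → m < suc n → ∀ {ys} → Tree m ys → 1 ≤ m → Nice ys) →
                Reduct xs n → 1 ≤ n → Nice xs
  from-reduct smaller (ys , r , t) 1≤n = nice-backwards r (smaller ≤-refl t 1≤n)
  nice-by-size : ∀ n → (∀ {m} → m < n → ∀ {xs} → Tree m xs → 1 ≤ m → Nice xs) →
                 ∀ {xs} → Tree n xs → 1 ≤ n → Nice xs
  nice-by-size _ smaller leaf ()
  nice-by-size _ smaller (node leaf leaf) _ = base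
  nice-by-size _ smaller (node tA@(node _ _) tB) _ = from-reduct smaller (reduce-node tA tB (s≤s z≤n)) (s≤s z≤n)
  nice-by-size _ smaller (node leaf tB@(node _ _)) _ = from-reduct smaller (reduce-node leaf tB (s≤s z≤n)) (s≤s z≤n)

raise-small : ∀ v {X} → All (_< v) X → map (raise v) X ≡ X
raise-small v [] = refl
raise-small v (x<v ∷ xs<v) = cong₂ _∷_ (raise-below x<v) (raise-small v xs<v)

-- The values v at position p+1 that undoing a reduction can create: p+1
-- (type 1; never at the first position, since values are at least 2) and
-- p+2 (type 2).
Insertable : ℕ → ℕ → Set
Insertable p v = (v ≡ suc p × 1 ≤ p) ⊎ (v ≡ suc (suc p))

insertable-≤ : ∀ {p v} → Insertable p v → v ≤ suc (suc p)
insertable-≤ (inj₁ (refl , _)) = n≤1+n _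
insertable-≤ (inj₂ refl) = ≤-refl

graft-raise-root : ∀ a b w → InRange b w → graft a (suc b) (graft 0 b w) ≡ raise (suc (suc a)) (graft a b w)
graft-raise-root a b w (lo , _) with w ≟ suc b
... | yes refl rewrite graft-top 0 b | graft-top a b
        | graft-shift a (suc b) {2} (λ e → <⇒≢ (s≤s (s≤s (≤-pred lo))) e)
        | raise-above {suc (suc a)} {suc (suc a)} ≤-refl = cong suc (+-comm a 2)
... | no w≢top rewrite graft-shift 0 b {w} w≢top | graft-shift a b {w} w≢top
        | graft-shift a (suc b) {suc w} (λ e → w≢top (suc-injective e))
        | raise-above {suc (suc a)} {suc (a + w)} (s≤s (a<a+b a (≤-trans (s≤s z≤n) lo))) = cong suc (+-suc a w)

graft-raise : ∀ a b v w → 2 ≤ v → v ≤ suc b → InRange b w → graft a (suc b) (raise v w) ≡ raise (suc (a + v)) (graft a b w)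
graft-raise a b v w 2≤v v≤ (lo , hi) with w ≟ suc b
... | yes refl rewrite raise-above v≤ | graft-top a (suc b) | graft-top a b
        | raise-below {suc (a + v)} {suc (suc a)} (s≤s (≤-trans (≤-reflexive (+-comm 2 a)) (+-monoʳ-≤ a 2≤v))) = refl
... | no w≢top rewrite graft-shift a b {w} w≢top with w <? v
...   | yes w<v rewrite raise-below w<v | graft-shift a (suc b) {w} (λ e → <⇒≢ (≤-trans (≤∧≢⇒< hi w≢top) (n≤1+n _)) e)
          | raise-below {suc (a + v)} {suc (a + w)} (s≤s (+-monoʳ-< a w<v)) = refl
...   | no w≮v rewrite raise-above (≮⇒≥ w≮v) | graft-shift a (suc b) {suc w} (λ e → w≢top (suc-injective e))
          | raise-above {suc (a + v)} {suc (a + w)} (s≤s (+-monoʳ-≤ a (≮⇒≥ w≮v))) = cong suc (+-suc a w)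

-- Inserting a value v after position p into the tree bijection of a node
-- gives again a tree bijection, in each of the four possible places: at the
-- very end, inside A, just before the root, or inside B.
insert-end : ∀ {n xs} → Tree n xs → Tree (suc n) (insert-at n (suc (suc n)) (map (raise (suc (suc n))) xs))
insert-end {n} {xs} t = Tree-cong (cong suc (+-identityʳ n)) eq (node t leaf)
  where
  eq : xs ++ suc (suc (n + 0)) ∷ [] ≡ insert-at n (suc (suc n)) (map (raise (suc (suc n))) xs)
  eq = begin
      xs ++ suc (suc (n + 0)) ∷ []
    ≡⟨ cong (λ k → xs ++ suc (suc k) ∷ []) (+-identityʳ n) ⟩
      xs ++ suc (suc n) ∷ []
    ≡⟨ sym (insert-at-end _ xs (tree-length t)) ⟩
      insert-at n (suc (suc n)) xs
    ≡⟨ cong (insert-at n (suc (suc n))) (sym (raise-small (suc (suc n)) (All.map (λ r → s≤s (proj₂ r)) (tree-range t)))) ⟩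
      insert-at n (suc (suc n)) (map (raise (suc (suc n))) xs)
    ∎
    where open ≡-Reasoning

insert-left : ∀ {a b A B} → Tree a A → Tree b B → ∀ p v → p ≤ a → Insertable p v →
  Tree (suc a) (insert-at p v (map (raise v) A)) →
  Tree (suc (suc (a + b))) (insert-at p v (map (raise v) (node-list a b A B)))
insert-left {a} {b} {A} {B} tA tB p v p≤a ins tA′ = Tree-cong refl (sym eq) (node tA′ tB)
  where
  M : ℕ
  M = suc (suc (a + b))
  v≤M : v ≤ M
  v≤M = ≤-trans (insertable-≤ ins) (s≤s (s≤s (≤-trans p≤a (m≤m+n a b))))
  raise-graft : ∀ {w} → InRange b w → raise v (graft a b w) ≡ graft (suc a) b w
  raise-graft r = trans (raise-above (≤-trans (insertable-≤ ins) (≤-trans (s≤s (s≤s p≤a)) (proj₁ (graft-range a b r)))))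
                        (sym (graft-suc a b _))
  eq : insert-at p v (map (raise v) (A ++ M ∷ map (graft a b) B)) ≡
       insert-at p v (map (raise v) A) ++ suc M ∷ map (graft (suc a) b) B
  eq = begin
      insert-at p v (map (raise v) (A ++ M ∷ map (graft a b) B))
    ≡⟨ cong (insert-at p v) (map-++ (raise v) A _) ⟩
      insert-at p v (map (raise v) A ++ raise v M ∷ map (raise v) (map (graft a b) B))
    ≡⟨ insert-at-++ˡ p v (map (raise v) A) _ (≤-trans p≤a (≤-reflexive (sym (trans (length-map (raise v) A) (tree-length tA))))) ⟩
      insert-at p v (map (raise v) A) ++ raise v M ∷ map (raise v) (map (graft a b) B)
    ≡⟨ cong (λ l → insert-at p v (map (raise v) A) ++ l)
            (cong₂ _∷_ (raise-above v≤M) (map-fuse (All.map raise-graft (tree-range tB)))) ⟩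
      insert-at p v (map (raise v) A) ++ suc M ∷ map (graft (suc a) b) B
    ∎
    where open ≡-Reasoning

insert-root : ∀ {a b A B} → Tree a A → Tree b B →
  Tree (suc (suc (a + b))) (insert-at (suc a) (suc (suc a)) (map (raise (suc (suc a))) (node-list a b A B)))
insert-root {a} {b} {A} {B} tA tB = Tree-cong (cong suc (+-suc a b)) (sym eq) (node tA (node leaf tB))
  where
  M : ℕ
  M = suc (suc (a + b))
  v : ℕ
  v = suc (suc a)
  eq : insert-at (suc a) v (map (raise v) (A ++ M ∷ map (graft a b) B)) ≡
       A ++ suc (suc (a + suc b)) ∷ map (graft a (suc b)) ([] ++ suc (suc (0 + b)) ∷ map (graft 0 b) B)
  eq = begin
      insert-at (suc a) v (map (raise v) (A ++ M ∷ map (graft a b) B))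
    ≡⟨ cong (insert-at (suc a) v) (map-++ (raise v) A _) ⟩
      insert-at (suc a) v (map (raise v) A ++ raise v M ∷ map (raise v) (map (graft a b) B))
    ≡⟨ cong (λ l → insert-at (suc a) v (l ++ raise v M ∷ map (raise v) (map (graft a b) B)))
            (raise-small v (All.map (λ r → s≤s (proj₂ r)) (tree-range tA))) ⟩
      insert-at (suc a) v (A ++ raise v M ∷ map (raise v) (map (graft a b) B))
    ≡⟨ cong (λ k → insert-at (suc k) v (A ++ raise v M ∷ map (raise v) (map (graft a b) B))) (sym (+-identityʳ a)) ⟩
      insert-at (suc (a + 0)) v (A ++ raise v M ∷ map (raise v) (map (graft a b) B))
    ≡⟨ insert-at-++ʳ 0 v A _ _ (tree-length tA) ⟩
      A ++ raise v M ∷ v ∷ map (raise v) (map (graft a b) B)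
    ≡⟨ cong (A ++_) (cong₂ _∷_ (trans (raise-above (s≤s (s≤s (m≤m+n a b)))) (cong (λ k → suc (suc k)) (sym (+-suc a b))))
                               (cong₂ _∷_ (sym (graft-top a (suc b)))
                                          (sym (trans (map-fuse (All.map (λ {w} r → graft-raise-root a b w r) (tree-range tB)))
                                                      (map-∘ B))))) ⟩
      A ++ suc (suc (a + suc b)) ∷ graft a (suc b) (suc (suc b)) ∷ map (graft a (suc b)) (map (graft 0 b) B)
    ∎
    where open ≡-Reasoning

insert-right : ∀ {a b A B} → Tree a A → Tree b B → ∀ q vB → 2 ≤ vB → vB ≤ suc b →
  Tree (suc b) (insert-at q vB (map (raise vB) B)) →
  Tree (suc (suc (a + b))) (insert-at (suc (a + q)) (suc (a + vB)) (map (raise (suc (a + vB))) (node-list a b A B)))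
insert-right {a} {b} {A} {B} tA tB q vB 2≤vB vB≤ tB′ = Tree-cong (cong suc (+-suc a b)) (sym eq) (node tA tB′)
  where
  M : ℕ
  M = suc (suc (a + b))
  v : ℕ
  v = suc (a + vB)
  eq : insert-at (suc (a + q)) v (map (raise v) (A ++ M ∷ map (graft a b) B)) ≡
       A ++ suc (suc (a + suc b)) ∷ map (graft a (suc b)) (insert-at q vB (map (raise vB) B))
  eq = begin
      insert-at (suc (a + q)) v (map (raise v) (A ++ M ∷ map (graft a b) B))
    ≡⟨ cong (insert-at (suc (a + q)) v) (map-++ (raise v) A _) ⟩
      insert-at (suc (a + q)) v (map (raise v) A ++ raise v M ∷ map (raise v) (map (graft a b) B))
    ≡⟨ cong (λ l → insert-at (suc (a + q)) v (l ++ raise v M ∷ map (raise v) (map (graft a b) B)))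
            (raise-small v (All.map (λ r → s≤s (≤-trans (proj₂ r) (a<a+b a (≤-trans (s≤s z≤n) 2≤vB)))) (tree-range tA))) ⟩
      insert-at (suc (a + q)) v (A ++ raise v M ∷ map (raise v) (map (graft a b) B))
    ≡⟨ insert-at-++ʳ q v A _ _ (tree-length tA) ⟩
      A ++ raise v M ∷ insert-at q v (map (raise v) (map (graft a b) B))
    ≡⟨ cong (A ++_) (cong₂ _∷_ (trans (raise-above (s≤s (≤-trans (+-monoʳ-≤ a vB≤) (≤-reflexive (+-suc a b)))))
                                      (cong (λ k → suc (suc k)) (sym (+-suc a b))))
                               (sym inner)) ⟩
      A ++ suc (suc (a + suc b)) ∷ map (graft a (suc b)) (insert-at q vB (map (raise vB) B))
    ∎
    where
    open ≡-Reasoning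
    inner : map (graft a (suc b)) (insert-at q vB (map (raise vB) B)) ≡ insert-at q v (map (raise v) (map (graft a b) B))
    inner = trans (map-insert-at (graft a (suc b)) q vB _)
                  (cong₂ (insert-at q) (graft-shift a (suc b) {vB} (λ e → <⇒≢ (s≤s vB≤) e))
                    (trans (map-fuse (All.map (λ {w} r → graft-raise a b vB w 2≤vB vB≤ r) (tree-range tB))) (map-∘ B)))

insert-past-left : ∀ {a b A B} → Tree a A → Tree b B →
  (∀ q v → q ≤ b → Insertable q v → Tree (suc b) (insert-at q v (map (raise v) B))) →
  ∀ q v → q ≤ b → Insertable (suc (a + q)) v →
  Tree (suc (suc (a + b))) (insert-at (suc (a + q)) v (map (raise v) (node-list a b A B)))
insert-past-left {a} tA tB _ zero _ _ (inj₁ (refl , _)) rewrite +-identityʳ a = insert-root tA tB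
insert-past-left {a} {b} {A} {B} tA tB insertB (suc q) _ q<b (inj₁ (refl , _)) =
  Tree-cong refl (cong (λ u → insert-at (suc (a + suc q)) u (map (raise u) (node-list a b A B)))
                       (cong suc (+-suc a (suc q))))
    (insert-right tA tB (suc q) (suc (suc q)) (s≤s (s≤s z≤n)) (s≤s q<b)
       (insertB (suc q) (suc (suc q)) q<b (inj₁ (refl , s≤s z≤n))))
insert-past-left {a} {b} {A} {B} tA tB insertB q _ q≤b (inj₂ refl) with q ≟ b
... | yes refl = insert-end (node tA tB)
... | no q≢b =
  Tree-cong refl (cong (λ u → insert-at (suc (a + q)) u (map (raise u) (node-list a b A B)))
                       (cong suc (trans (+-suc a (suc q)) (cong suc (+-suc a q)))))
    (insert-right tA tB q (suc (suc q)) (s≤s (s≤s z≤n)) (s≤s (≤∧≢⇒< q≤b q≢b))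
       (insertB q (suc (suc q)) q≤b (inj₂ refl)))

tree-insert : ∀ {n xs} → Tree n xs → ∀ p v → p ≤ n → Insertable p v → Tree (suc n) (insert-at p v (map (raise v) xs))
tree-insert leaf zero v z≤n (inj₁ (_ , ()))
tree-insert leaf zero .(suc (suc zero)) z≤n (inj₂ refl) = node leaf leaf
tree-insert (node {a} {b} tA tB) p v p≤n ins with p ≤? a
... | yes p≤a = insert-left tA tB p v p≤a ins (tree-insert tA p v p≤a ins)
... | no p≰a with m≤n⇒∃[o]m+o≡n (≰⇒> p≰a)
...   | q , refl = insert-past-left tA tB (tree-insert tB) q v (+-cancelˡ-≤ a q b (≤-pred p≤n)) ins

raise-ψ : ∀ i u → u ≢ i → raise i (ψ i u) ≡ u
raise-ψ i u u≢i with <-cmp u i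
... | tri< u<i _ _ = trans (cong (raise i) (ψ-below u<i)) (raise-below u<i)
... | tri≈ _ u≡i _ = ⊥-elim (u≢i u≡i)
raise-ψ i (suc u) _ | tri> _ _ i<u = trans (cong (raise i) (ψ-above (≤-trans (n≤1+n i) i<u))) (raise-above (≤-pred i<u))

ψ-range : ∀ i k u → 2 ≤ i → i ≤ suc k → u ≢ i → InRange (suc k) u → InRange k (ψ i u)
ψ-range i k u 2≤i i≤ u≢i (lo , hi) with <-cmp u i
... | tri< u<i _ _ rewrite ψ-below u<i = lo , ≤-trans (≤-trans (n≤1+n u) u<i) i≤
... | tri≈ _ u≡i _ = ⊥-elim (u≢i u≡i)
ψ-range i k (suc u) 2≤i i≤ u≢i (lo , hi) | tri> _ _ i<u rewrite ψ-above (≤-trans (n≤1+n i) i<u) =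
  ≤-trans 2≤i (≤-pred i<u) , ≤-pred hi

raise-φ : ∀ i u → u ≢ suc i → raise (suc i) (φ i u) ≡ u
raise-φ i u u≢i+1 with <-cmp u (suc i)
... | tri< u<i+1 _ _ = trans (cong (raise (suc i)) (φ-below (≤-pred u<i+1))) (raise-below u<i+1)
... | tri≈ _ u≡i+1 _ = ⊥-elim (u≢i+1 u≡i+1)
raise-φ i (suc u) _ | tri> _ _ i+1<u = trans (cong (raise (suc i)) (φ-above (m≤n⇒m≤1+n (≤-pred i+1<u)))) (raise-above (≤-pred i+1<u))

φ-range : ∀ i k u → 1 ≤ i → i ≤ suc k → u ≢ suc i → InRange (suc k) u → InRange k (φ i u)
φ-range i k u 1≤i i≤ u≢i+1 (lo , hi) with <-cmp u (suc i)
... | tri< u<i+1 _ _ rewrite φ-below (≤-pred u<i+1) = lo , ≤-trans (≤-pred u<i+1) i≤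
... | tri≈ _ u≡i+1 _ = ⊥-elim (u≢i+1 u≡i+1)
φ-range i k (suc u) 1≤i i≤ u≢i+1 (lo , hi) | tri> _ _ i+1<u rewrite φ-above (m≤n⇒m≤1+n (≤-pred i+1<u)) =
  ≤-trans (s≤s 1≤i) (≤-pred i+1<u) , ≤-pred hi

unreduce : ∀ ys zs (x : ℕ) (R : ℕ → ℕ) →
  (∀ u → u ≢ x → raise x (R u) ≡ u) →
  (∀ u → u ≢ x → InRange (suc (length (ys ++ zs))) u → InRange (length (ys ++ zs)) (R u)) →
  Insertable (length ys) x →
  Bij (suc (length (ys ++ zs))) (ys ++ x ∷ zs) →
  (Bij (length (ys ++ zs)) (map R (ys ++ zs)) → Tree (length (ys ++ zs)) (map R (ys ++ zs))) →
  Tree (suc (length (ys ++ zs))) (ys ++ x ∷ zs)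
unreduce ys zs x R raise-R R-range ins (u , r , _) reduced-tree =
  Tree-cong refl (trans (cong (insert-at (length ys) x) restore) (insert-at-mid ys x zs))
    (tree-insert (reduced-tree reduced-bij) (length ys) x (length-++-≤ˡ ys) ins)
  where
  others≢x : All (_≢ x) (ys ++ zs)
  others≢x = proj₁ (unique-mid ys u)
  restore : map (raise x) (map R (ys ++ zs)) ≡ ys ++ zs
  restore = trans (map-fuse {h = λ w → w} (All.map (λ {w} w≢x → raise-R w w≢x) others≢x)) (map-id (ys ++ zs))
  reduced-bij : Bij (length (ys ++ zs)) (map R (ys ++ zs))
  reduced-bij = UniqueP.map⁻ (subst Unique (sym restore) (proj₂ (unique-mid ys u))) ,
                AllP.map⁺ (All.zipWith (λ {w} (w≢x , rw) → R-range w w≢x rw) (others≢x , proj₂ (All-mid ys r))) ,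
                length-map R (ys ++ zs)

nice⇒tree : ∀ {xs} → Nice xs → ∀ {k} → Bij k xs → Tree k xs
nice⇒tree base (_ , _ , refl) = node leaf leaf
nice⇒tree (type1 ys zs n) b@(_ , r , len) with trans (sym len) (length-mid ys (suc (length ys)) zs)
... | refl = unreduce ys zs (suc (length ys)) (ψ (suc (length ys))) (raise-ψ _)
               (λ w w≢ rw → ψ-range _ _ w 2≤i (s≤s (length-++-≤ˡ ys)) w≢ rw)
               (inj₁ (refl , ≤-pred 2≤i)) b (nice⇒tree n)
  where
  2≤i : 2 ≤ suc (length ys)
  2≤i = proj₁ (proj₁ (All-mid ys r))
nice⇒tree (type2 ys zs _ n) b@(_ , _ , len) with trans (sym len) (length-mid ys (suc (suc (length ys))) zs)
... | refl = unreduce ys zs (suc (suc (length ys))) (φ (suc (length ys))) (raise-φ _)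
               (λ w w≢ rw → φ-range _ _ w (s≤s z≤n) (s≤s (length-++-≤ˡ ys)) w≢ rw)
               (inj₂ refl) b (nice⇒tree n)

merge : List ℕ → List ℕ → List ℕ
merge A B = node-list (length A) (length B) A B

merge-node : ∀ {a b A B} → Tree a A → Tree b B → merge A B ≡ node-list a b A B
merge-node tA tB rewrite tree-length tA | tree-length tB = refl

Forest : ℕ → ℕ → List (List ℕ) → Set
Forest h m t = length t ≡ suc h × All (λ c → Σ ℕ λ n → Tree n c) t × sum (map length t) ≡ m

merge-first : List (List ℕ) → List (List ℕ)
merge-first (A ∷ B ∷ t) = merge A B ∷ t
merge-first _ = []

-- All forests of h+1 trees with m nodes, following the recursion of ballot:
-- either the first tree is empty, or it is a merge of two trees.
forests : ℕ → ℕ → List (List (List ℕ))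
forests h zero = replicate (suc h) [] ∷ []
forests zero (suc m) = map merge-first (forests 1 m)
forests (suc h) (suc m) = map ([] ∷_) (forests h (suc m)) ++ map merge-first (forests (suc (suc h)) m)

forests-length : ∀ h m → length (forests h m) ≡ ballot h m
forests-length h zero = refl
forests-length zero (suc m) = trans (length-map merge-first (forests 1 m)) (forests-length 1 m)
forests-length (suc h) (suc m) = trans (length-++ (map ([] ∷_) (forests h (suc m))))
  (cong₂ _+_ (trans (length-map _ (forests h (suc m))) (forests-length h (suc m)))
             (trans (length-map merge-first (forests (suc (suc h)) m)) (forests-length (suc (suc h)) m)))

merge-first-forest : ∀ {h m t} → Forest (suc h) m t → Forest h (suc m) (merge-first t)
merge-first-forest {t = A ∷ B ∷ t} (len , (_ , tA) ∷ (_ , tB) ∷ ts , size) =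
  suc-injective len , (_ , Tree-cong refl (sym (merge-node tA tB)) (node tA tB)) ∷ ts ,
  (begin
     length (merge A B) + sum (map length t)
   ≡⟨ cong (_+ sum (map length t)) (length-mid A _ (map (graft (length A) (length B)) B)) ⟩
     suc (length (A ++ map (graft (length A) (length B)) B)) + sum (map length t)
   ≡⟨ cong (λ l → suc l + sum (map length t)) (trans (length-++ A) (cong (length A +_) (length-map _ B))) ⟩
     suc (length A + length B + sum (map length t))
   ≡⟨ cong suc (trans (+-assoc (length A) (length B) _) size) ⟩
     suc _
   ∎)
  where open ≡-Reasoning

cons-empty : ∀ {h m t} → Forest h m t → Forest (suc h) m ([] ∷ t)
cons-empty (len , ts , size) = cong suc len , (0 , leaf) ∷ ts , size

empty-forest : ∀ h → Forest h 0 (replicate (suc h) [])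
empty-forest zero = refl , (0 , leaf) ∷ [] , refl
empty-forest (suc h) = cons-empty (empty-forest h)

forests-sound : ∀ h m {t} → t ∈ forests h m → Forest h m t
forests-sound h zero (here refl) = empty-forest h
forests-sound zero (suc m) = ∈-map-elim {Q = Forest 0 (suc m)} merge-first (λ t∈ → merge-first-forest (forests-sound 1 m t∈))
forests-sound (suc h) (suc m) t∈ =
  [ ∈-map-elim {Q = Forest (suc h) (suc m)} ([] ∷_) (λ t∈ → cons-empty (forests-sound h (suc m) t∈)) ,
    ∈-map-elim {Q = Forest (suc h) (suc m)} merge-first (λ t∈ → merge-first-forest (forests-sound (suc (suc h)) m t∈)) ]′
  (∈-++⁻ (map ([] ∷_) (forests h (suc m))) t∈)

all-empty : ∀ n {t : List (List ℕ)} → length t ≡ n → sum (map length t) ≡ 0 → t ≡ replicate n []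
all-empty zero {[]} _ _ = refl
all-empty (suc n) {[] ∷ t} len size = cong ([] ∷_) (all-empty n (suc-injective len) size)

size-split : ∀ {a b A B} (t : List (List ℕ)) {m} → Tree a A → Tree b B →
             length (node-list a b A B) + sum (map length t) ≡ suc m →
             length A + (length B + sum (map length t)) ≡ m
size-split {a} {b} {A} {B} t tA tB size rewrite tree-length (node tA tB) | tree-length tA | tree-length tB =
  trans (sym (+-assoc a b _)) (suc-injective size)

-- Every forest is listed; a first tree that is a node comes from merge-first.
complete-single : ∀ m → (∀ {t} → Forest 1 m t → t ∈ forests 1 m) →
                  ∀ {t} → Forest 0 (suc m) t → t ∈ map merge-first (forests 1 m)
complete-single m complete {c ∷ []} (_ , (_ , leaf) ∷ [] , ())
complete-single m complete {c ∷ []} (_ , (_ , node tA tB) ∷ [] , size) =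
  subst (λ c → c ∷ [] ∈ map merge-first (forests 1 m)) (merge-node tA tB)
    (∈-map⁺ merge-first (complete (refl , (_ , tA) ∷ (_ , tB) ∷ [] , size-split [] tA tB size)))

complete-cons : ∀ h m → (∀ {t} → Forest h (suc m) t → t ∈ forests h (suc m)) →
                (∀ {t} → Forest (suc (suc h)) m t → t ∈ forests (suc (suc h)) m) →
                ∀ {t} → Forest (suc h) (suc m) t → t ∈ map ([] ∷_) (forests h (suc m)) ++ map merge-first (forests (suc (suc h)) m)
complete-cons h m complete₁ complete₂ {c ∷ t} (len , (_ , leaf) ∷ ts , size) =
  ∈-++⁺ˡ (∈-map⁺ ([] ∷_) (complete₁ (suc-injective len , ts , size)))
complete-cons h m complete₁ complete₂ {c ∷ t} (len , (_ , node tA tB) ∷ ts , size) =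
  ∈-++⁺ʳ (map ([] ∷_) (forests h (suc m)))
    (subst (λ c → c ∷ t ∈ map merge-first (forests (suc (suc h)) m)) (merge-node tA tB)
      (∈-map⁺ merge-first (complete₂ (cong suc len , (_ , tA) ∷ (_ , tB) ∷ ts , size-split t tA tB size))))

forests-complete : ∀ h m {t} → Forest h m t → t ∈ forests h m
forests-complete h zero (len , _ , size) = here (all-empty (suc h) len size)
forests-complete zero (suc m) = complete-single m (forests-complete 1 m)
forests-complete (suc h) (suc m) = complete-cons h m (forests-complete h (suc m)) (forests-complete (suc (suc h)) m)

sizes : ∀ {a b a′ b′ A B A′ B′} → Tree a A → Tree b B → Tree a′ A′ → Tree b′ B′ →
  node-list a b A B ≡ node-list a′ b′ A′ B′ → a + b ≡ a′ + b′
sizes tA tB tA′ tB′ eq =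
  suc-injective (trans (sym (tree-length (node tA tB))) (trans (cong length eq) (tree-length (node tA′ tB′))))

root∉ : ∀ {c e C} → Tree c C → ¬ (suc (suc (c + e)) ∈ C)
root∉ {c} {e} tC r∈ = <⇒≱ (s≤s (proj₂ (All.lookup (tree-range tC) r∈))) (s≤s (s≤s (m≤m+n c e)))

-- A node determines its two subtrees: the root value a+b+2 is the maximum,
-- so it sits at the same position in both lists.
node-injective : ∀ {a b a′ b′ A B A′ B′} → Tree a A → Tree b B → Tree a′ A′ → Tree b′ B′ →
  node-list a b A B ≡ node-list a′ b′ A′ B′ → A ≡ A′ × B ≡ B′
node-injective {a} {b} {a′} {b′} {A} {B} {A′} {B′} tA tB tA′ tB′ eq with <-cmp a a′
... | tri< a<a′ _ _ = ⊥-elim (root∉ tA′ (subst (λ d → suc (suc d) ∈ A′) (sizes tA tB tA′ tB′ eq)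
                        (mid∈ A A′ (subst₂ _<_ (sym (tree-length tA)) (sym (tree-length tA′)) a<a′) eq)))
... | tri> _ _ a′<a = ⊥-elim (root∉ tA (subst (λ d → suc (suc d) ∈ A) (sym (sizes tA tB tA′ tB′ eq))
                        (mid∈ A′ A (subst₂ _<_ (sym (tree-length tA′)) (sym (tree-length tA)) a′<a) (sym eq))))
... | tri≈ _ refl _ with ++-split A A′ (trans (tree-length tA) (sym (tree-length tA′))) eq
...   | refl , rest with ∷-injective rest
...     | roots , grafted with +-cancelˡ-≡ a b b′ (suc-injective (suc-injective roots))
...       | refl = refl , map-injective-on (graft a b) (graft-injective a b) (tree-range tB) (tree-range tB′) grafted

merge-first-injective : ∀ {h m t t′} → Forest (suc h) m t → Forest (suc h) m t′ → merge-first t ≡ merge-first t′ → t ≡ t′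
merge-first-injective {t = A ∷ B ∷ r} {t′ = A′ ∷ B′ ∷ r′}
  (_ , (_ , tA) ∷ (_ , tB) ∷ _ , _) (_ , (_ , tA′) ∷ (_ , tB′) ∷ _ , _) eq with ∷-injective eq
... | merged , refl with node-injective tA tB tA′ tB′ (trans (sym (merge-node tA tB)) (trans merged (merge-node tA′ tB′)))
...   | refl , refl = refl

-- A merge is never empty, so the two parts of forests (suc h) (suc m) are disjoint.
merge-first≢empty-first : ∀ t t′ → merge-first t ≢ [] ∷ t′
merge-first≢empty-first [] t′ ()
merge-first≢empty-first (_ ∷ []) t′ ()
merge-first≢empty-first (A ∷ B ∷ r) t′ eq = nonempty A (proj₁ (∷-injective eq))
  where
  nonempty : ∀ (A : List ℕ) {x R} → A ++ x ∷ R ≢ []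
  nonempty [] ()
  nonempty (_ ∷ _) ()

forests-unique : ∀ h m → Unique (forests h m)
forests-unique h zero = [] ∷ []
forests-unique zero (suc m) =
  unique-map-on merge-first merge-first-injective (All.tabulate (forests-sound 1 m)) (forests-unique 1 m)
forests-unique (suc h) (suc m) =
  UniqueP.++⁺ (UniqueP.map⁺ (λ e → proj₂ (∷-injective e)) (forests-unique h (suc m)))
              (unique-map-on merge-first merge-first-injective (All.tabulate (forests-sound (suc (suc h)) m))
                             (forests-unique (suc (suc h)) m))
              disjoint
  where
  disjoint : ∀ {t} → ¬ (t ∈ map ([] ∷_) (forests h (suc m)) × t ∈ map merge-first (forests (suc (suc h)) m))
  disjoint (t∈₁ , t∈₂) with ∈-map⁻ ([] ∷_) t∈₁ | ∈-map⁻ merge-first t∈₂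
  ... | t₁ , _ , refl | t₂ , _ , eq = merge-first≢empty-first t₂ t₁ (sym eq)

nice⇔tree : ∀ {n xs} → 1 ≤ n → (IsBij n xs × Nice xs) ⇔ Tree n xs
nice⇔tree {n} 1≤n = mk⇔ (λ (bij , nice) → nice⇒tree nice (isBij⇒bij bij))
                         (λ t → tree⇒isBij t , tree⇒nice n t 1≤n)

first : List (List ℕ) → List ℕ
first [] = []
first (c ∷ _) = c

single-tree : ∀ {n t} → Forest 0 n t → Tree n (first t)
single-tree {t = c ∷ []} (_ , (_ , tc) ∷ [] , size) =
  Tree-cong (trans (sym (tree-length tc)) (trans (sym (+-identityʳ _)) size)) refl tc

trees : ℕ → List (List ℕ)
trees n = map first (forests 0 n)

∈-trees : ∀ {n xs} → xs ∈ trees n ⇔ Tree n xs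
∈-trees {n} = mk⇔ (∈-map-elim {Q = Tree n} first (λ t∈ → single-tree (forests-sound 0 n t∈)))
                  (λ t → ∈-map⁺ first (forests-complete 0 n (refl , (n , t) ∷ [] , trans (+-identityʳ _) (tree-length t))))

trees-unique : ∀ n → Unique (trees n)
trees-unique n = unique-map-on first single-injective (All.tabulate (forests-sound 0 n)) (forests-unique 0 n)
  where
  single-injective : ∀ {t t′} → Forest 0 n t → Forest 0 n t′ → first t ≡ first t′ → t ≡ t′
  single-injective {c ∷ []} {c′ ∷ []} _ _ refl = refl

trees-length : ∀ n → length (trees n) ≡ catalan n
trees-length n = trans (length-map first (forests 0 n)) (trans (forests-length 0 n) (sym (catalan≡ballot n)))

lemma7 : (n : ℕ) → 1 ≤ n → Seq-a n (catalan (n ∸ 1))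
lemma7 (suc zero) _ = refl
lemma7 (suc (suc k)) _ =
  trees (suc k) , trees-unique (suc k) ,
  (λ xs → ⇔.trans ∈-trees (⇔.sym (nice⇔tree (s≤s z≤n)))) , trees-length (suc k)
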